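{- Let $m\geq 3$ and $k$ be positive integers. The odd girth of the helical graph $H(m,1,k)$ equals $2k+2\left\lceil\frac{2k-1}{m-2}\right\rceil-1$.
   Context: The odd girth of a graph is the length of a shortest odd cycle. For positive integers $m,n,k$ with $m\ge 2n$, the helical graph $H(m,n,k)$ has as vertices all $k$-tuples $(A_1,\ldots,A_k)$ of subsets of $\{1,\ldots,m\}$ with $|A_1|=n$, $|A_i|\ge n$ for all $i$, $A_i\cap A_{i+1}=\emptyset$ for $i\le k-1$, and $A_t\subseteq A_{t+2}$ for $t\le k-2$; $(A_1,\ldots,A_k)$ and $(B_1,\ldots,B_k)$ are adjacent iff $A_i\cap B_i=\emptyset$ for all $1\le i\le k$ and $A_j\subseteq B_{j+1}$, $B_j\subseteq A_{j+1}$ for all $1\le j\le k-1$. -}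

module Defs where

open import Data.Nat using (ℕ; zero; suc; _+_; _*_; _∸_; _≤_; _≡ᵇ_; NonZero)
open import Data.Nat.DivMod using (_/_)
open import Data.Fin using (Fin; toℕ)
open import Data.Fin.Subset using (Subset; _∩_; _⊆_; ⊥; ∣_∣)
open import Data.Product using (_×_; Σ)
open import Relation.Binary.PropositionalEquality using (_≡_)

Odd : ℕ → Set
Odd n = Σ ℕ (λ t → n ≡ suc (2 * t))

-- A vertex of H(m,n,k) is a k-tuple (A_1,...,A_k) of subsets of an m-element set,
-- represented as a function Fin k → Subset m (index 0 stands for A_1).
Tuple : ℕ → ℕ → Set
Tuple m k = Fin k → Subset m

IsHelicalVertex : (m n k : ℕ) → Tuple m k → Set
IsHelicalVertex m n k A =
    (∀ (i : Fin k) → toℕ i ≡ 0 → ∣ A i ∣ ≡ n)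
  × (∀ (i : Fin k) → n ≤ ∣ A i ∣)
  × (∀ (i j : Fin k) → toℕ j ≡ suc (toℕ i) → A i ∩ A j ≡ ⊥)
  × (∀ (i j : Fin k) → toℕ j ≡ 2 + toℕ i → A i ⊆ A j)

HelicalAdj : (m k : ℕ) → Tuple m k → Tuple m k → Set
HelicalAdj m k A B =
    (∀ (i : Fin k) → A i ∩ B i ≡ ⊥)
  × (∀ (i j : Fin k) → toℕ j ≡ suc (toℕ i) → A i ⊆ B j)
  × (∀ (i j : Fin k) → toℕ j ≡ suc (toℕ i) → B i ⊆ A j)

IsHelicalCycle : (m n k L : ℕ) → (Fin L → Tuple m k) → Set
IsHelicalCycle m n k L c =
    3 ≤ L
  × (∀ (p : Fin L) → IsHelicalVertex m n k (c p))
  × (∀ (p q : Fin L) → (∀ (i : Fin k) → c p i ≡ c q i) → p ≡ q)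
  × (∀ (p q : Fin L) → toℕ q ≡ suc (toℕ p) → HelicalAdj m k (c p) (c q))
  × (∀ (p q : Fin L) → toℕ p ≡ 0 → suc (toℕ q) ≡ L → HelicalAdj m k (c q) (c p))

HasHelicalCycle : (m n k L : ℕ) → Set
HasHelicalCycle m n k L = Σ (Fin L → Tuple m k) (IsHelicalCycle m n k L)

HelicalOddGirth : (m n k g : ℕ) → Set
HelicalOddGirth m n k g =
    (Odd g × HasHelicalCycle m n k g)
  × (∀ (L : ℕ) → Odd L → HasHelicalCycle m n k L → g ≤ L)

⌈_/_⌉ : (a b : ℕ) → .{{NonZero b}} → ℕ
⌈ a / b ⌉ = (a + (b ∸ 1)) / b

-- Encode a vertex (A₁, …, A_k) of H(m, 1, k) by a level ℓ(x) ∈ {0, …, k} of each element x: x lies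
-- in A_{i+1} iff ℓ(x) ≤ i and i − ℓ(x) is even. Then A₁ is the singleton of the level-0 element, and
-- passing to an adjacent vertex moves every level by one or keeps it at k.
--
-- Lower bound: along an odd closed walk of length 2e + 1, an element re-enters A₁ after an even
-- number (≥ 2) of steps, or after an odd number 2h + 1 of steps only if h ≥ k. Its return times add
-- up to 2e + 1, so one of them is odd, hence at least 2k + 1, and the element occupies A₁ at most
-- c = e − k + 1 times. Counting the occupants of A₁ gives 2e + 1 ≤ m c, that is c ≥ ⌈(2k − 1)/(m − 2)⌉.
--
-- Upper bound: for c = ⌈(2k − 1)/(m − 2)⌉ and g = 2k + 2c − 1 ≤ m c, let x be at level 0 at time t
-- exactly when the residue P with 2P ≡ t (mod g) lies in the block [x c, x c + c); between these
-- times its level alternates 0, 1, 0, …, and otherwise it climbs to k and back. This is a closed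
-- walk of length g, and its vertices are distinct since a repetition would leave a shorter odd
-- closed walk.

module Submission where

open import Data.Nat
  using ( ℕ; zero; suc; _+_; _*_; _∸_; _≤_; _<_; _⊓_; z≤n; s≤s; NonZero; >-nonZero; >-nonZero⁻¹
        ; _≤?_; _<?_; _/_; _%_; pred)
open import Data.Nat.Properties hiding (_≟_)
open import Data.Nat.DivMod
open import Data.Nat.Divisibility using (n∣m*n)
open import Data.Nat.Tactic.RingSolver using (solve-∀)
open import Data.Bool using (Bool; true; false; if_then_else_)
open import Data.Fin using (Fin; toℕ; fromℕ<) renaming (zero to fzero; suc to fsuc)
open import Data.Fin.Properties using (toℕ-injective; toℕ-fromℕ<; toℕ<n; _≟_)
open import Data.Fin.Subset using (Subset; _∈_; _∩_; _⊆_; ∣_∣; ⁅_⁆; Nonempty) renaming (⊥ to ∅)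
open import Data.Fin.Subset.Properties
  using ( Empty-unique; nonempty?; ∣⊥∣≡0; ∉⊥; x∈⁅x⁆; x∈⁅y⁆⇒x≡y; ∣⁅x⁆∣≡1; p⊆q⇒∣p∣≤∣q∣; ⊆-antisym
        ; x∈p∩q⁺; x∈p∩q⁻)
open import Data.Vec using (tabulate)
open import Data.Vec.Properties using (lookup∘tabulate; []=⇒lookup; lookup⇒[]=; tabulate-cong)
open import Algebra.Properties.CommutativeMonoid.Sum +-0-commutativeMonoid
  using (sum-syntax; ∑-distrib-+; sum-replicate-zero)
open import Data.Product using (∃-syntax; _×_; _,_; proj₁; proj₂)
open import Data.Sum using (_⊎_; inj₁; inj₂)
open import Data.Empty using (⊥; ⊥-elim)
open import Function.Bundles using (_⇔_; mk⇔; Equivalence)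
open import Relation.Nullary using (¬_; yes; no; does; contradiction)
open import Relation.Nullary.Decidable using (dec-true)
open import Relation.Binary.Definitions using (tri<; tri≈; tri>)
open import Relation.Binary.PropositionalEquality
open import Defs

even⊎odd : ∀ n → (∃[ h ] n ≡ 2 * h) ⊎ (∃[ h ] n ≡ suc (2 * h))
even⊎odd zero = inj₁ (0 , refl)
even⊎odd (suc n) with even⊎odd n
... | inj₁ (h , refl) = inj₂ (h , refl)
... | inj₂ (h , refl) = inj₁ (suc h , cong suc (sym (+-suc h (h + 0))))

⌈/⌉-least : ∀ a b c .{{_ : NonZero b}} → a ≤ b * c → ⌈ a / b ⌉ ≤ c
⌈/⌉-least a (suc b) c a≤bc = ≤-pred (m<n*o⇒m/o<n (begin-strict
  a + b             <⟨ +-mono-≤-< (≤-trans a≤bc (≤-reflexive (*-comm (suc b) c))) (n<1+n b) ⟩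
  c * suc b + suc b ≡⟨ +-comm (c * suc b) (suc b) ⟩
  suc c * suc b     ∎))
  where open ≤-Reasoning

⌈/⌉-bound : ∀ a b .{{_ : NonZero b}} → a ≤ b * ⌈ a / b ⌉
⌈/⌉-bound a (suc b) = +-cancelʳ-≤ b a _ (begin
  a + b                                   ≡⟨ m≡m%n+[m/n]*n (a + b) (suc b) ⟩
  (a + b) % suc b + (a + b) / suc b * suc b ≤⟨ +-monoˡ-≤ _ (≤-pred (m%n<n (a + b) (suc b))) ⟩
  b + (a + b) / suc b * suc b             ≡⟨ cong (b +_) (*-comm ((a + b) / suc b) (suc b)) ⟩
  b + suc b * ((a + b) / suc b)           ≡⟨ +-comm b _ ⟩
  suc b * ((a + b) / suc b) + b           ∎)
  where open ≤-Reasoning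

2[k+c]+1≤[3+m]c⇔2k+1≤[1+m]c : ∀ m k c → suc (2 * (k + c)) ≤ (3 + m) * c ⇔ suc (2 * k) ≤ suc m * c
2[k+c]+1≤[3+m]c⇔2k+1≤[1+m]c m k c =
  mk⇔ (λ le → +-cancelˡ-≤ (2 * c) _ _ (subst₂ _≤_ (lhs k c) (rhs m c) le))
      (λ le → subst₂ _≤_ (sym (lhs k c)) (sym (rhs m c)) (+-monoʳ-≤ (2 * c) le))
  where
  lhs : ∀ k c → suc (2 * (k + c)) ≡ 2 * c + suc (2 * k)
  lhs = solve-∀
  rhs : ∀ m c → (3 + m) * c ≡ 2 * c + suc m * c
  rhs = solve-∀

suc-% : ∀ t L .{{_ : NonZero L}} → suc t % L ≡ suc (t % L) % L
suc-% t L = trans (cong (λ n → suc n % L) (m≡m%n+[m/n]*n t L)) ([m+kn]%n≡m%n (suc (t % L)) (t / L) L)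

suc-%-cases : ∀ t L .{{_ : NonZero L}} →
  (suc (t % L) < L × suc t % L ≡ suc (t % L)) ⊎ (suc (t % L) ≡ L × suc t % L ≡ 0)
suc-%-cases t L with suc (t % L) <? L
... | yes 1+r<L = inj₁ (1+r<L , trans (suc-% t L) (m<n⇒m%n≡m 1+r<L))
... | no 1+r≮L = inj₂ (1+r≡L , trans (suc-% t L) (trans (cong (_% L) 1+r≡L) (n%n≡0 L)))
  where
  1+r≡L : suc (t % L) ≡ L
  1+r≡L = ≤-antisym (m%n<n t L) (≮⇒≥ 1+r≮L)

+-cong-% : ∀ {a a′ b b′} d .{{_ : NonZero d}} →
           a % d ≡ a′ % d → b % d ≡ b′ % d → (a + b) % d ≡ (a′ + b′) % d
+-cong-% {a} {a′} {b} {b′} d a≡a′ b≡b′ = begin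
  (a + b) % d             ≡⟨ %-distribˡ-+ a b d ⟩
  (a % d + b % d) % d     ≡⟨ cong₂ (λ x y → (x + y) % d) a≡a′ b≡b′ ⟩
  (a′ % d + b′ % d) % d   ≡⟨ %-distribˡ-+ a′ b′ d ⟨
  (a′ + b′) % d           ∎
  where open ≡-Reasoning

[m*n+o]/n≡m : ∀ m n {o} .{{_ : NonZero n}} → o < n → (m * n + o) / n ≡ m
[m*n+o]/n≡m m n {o} o<n = begin
  (m * n + o) / n     ≡⟨ +-distrib-/-∣ˡ o (n∣m*n m) ⟩
  m * n / n + o / n   ≡⟨ cong₂ _+_ (m*n/n≡m m n) (m<n⇒m/n≡0 o<n) ⟩
  m + 0               ≡⟨ +-identityʳ m ⟩
  m                   ∎
  where open ≡-Reasoning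

∑-indicator : ∀ {m} (y : Fin m) → ∑[ x < m ] (if does (y ≟ x) then 1 else 0) ≡ 1
∑-indicator {suc m} fzero = cong suc (sum-replicate-zero m)
∑-indicator (fsuc y) = ∑-indicator y

∑-≤ : ∀ {m} (f : Fin m → ℕ) {c} → (∀ x → f x ≤ c) → ∑[ x < m ] f x ≤ m * c
∑-≤ {zero} f _ = z≤n
∑-≤ {suc m} f f≤c = +-mono-≤ (f≤c fzero) (∑-≤ (λ x → f (fsuc x)) (λ x → f≤c (fsuc x)))

-- Halving modulo the odd number 2h + 1: multiplication by h + 1 inverts doubling.
module Halving (h : ℕ) where

  private
    g : ℕ
    g = suc (2 * h)

    2n[1+h]≡n+n[1+2h] : ∀ n h → 2 * n * suc h ≡ n + n * suc (2 * h)
    2n[1+h]≡n+n[1+2h] = solve-∀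

  half : ℕ → ℕ
  half t = t * suc h % g

  half<g : ∀ t → half t < g
  half<g t = m%n<n (t * suc h) g

  half-cong : ∀ {t t′} → t % g ≡ t′ % g → half t ≡ half t′
  half-cong {t} {t′} t≡t′ = begin
    t * suc h % g                       ≡⟨ %-distribˡ-* t (suc h) g ⟩
    (t % g) * (suc h % g) % g           ≡⟨ cong (λ n → n * (suc h % g) % g) t≡t′ ⟩
    (t′ % g) * (suc h % g) % g          ≡⟨ %-distribˡ-* t′ (suc h) g ⟨
    t′ * suc h % g                      ∎
    where open ≡-Reasoning

  half-double : ∀ {P} → P < g → half (2 * P) ≡ P
  half-double {P} P<g = begin
    2 * P * suc h % g   ≡⟨ cong (_% g) (2n[1+h]≡n+n[1+2h] P h) ⟩
    (P + P * g) % g     ≡⟨ [m+kn]%n≡m%n P P g ⟩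
    P % g               ≡⟨ m<n⇒m%n≡m P<g ⟩
    P                   ∎
    where open ≡-Reasoning

  double-half : ∀ t → 2 * half t % g ≡ t % g
  double-half t = begin
    2 * half t % g                     ≡⟨ %-distribˡ-* 2 (half t) g ⟩
    (2 % g) * (half t % g) % g          ≡⟨ cong (λ n → (2 % g) * n % g) (m%n%n≡m%n (t * suc h) g) ⟩
    (2 % g) * (t * suc h % g) % g       ≡⟨ %-distribˡ-* 2 (t * suc h) g ⟨
    2 * (t * suc h) % g                ≡⟨ cong (_% g) (trans (sym (*-assoc 2 t (suc h))) (2n[1+h]≡n+n[1+2h] t h)) ⟩
    (t + t * g) % g                    ≡⟨ [m+kn]%n≡m%n t t g ⟩
    t % g                              ∎
    where open ≡-Reasoning

module _ {m : ℕ} where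

  ∈-tabulate⁺ : (f : Fin m → Bool) {x : Fin m} → f x ≡ true → x ∈ tabulate f
  ∈-tabulate⁺ f {x} fx = lookup⇒[]= x (tabulate f) (trans (lookup∘tabulate f x) fx)

  ∈-tabulate⁻ : (f : Fin m → Bool) {x : Fin m} → x ∈ tabulate f → f x ≡ true
  ∈-tabulate⁻ f {x} x∈ = trans (sym (lookup∘tabulate f x)) ([]=⇒lookup x∈)

  disjoint⇒∩≡∅ : (p q : Subset m) → (∀ {x} → x ∈ p → x ∈ q → ⊥) → p ∩ q ≡ ∅
  disjoint⇒∩≡∅ p q disj = Empty-unique λ (x , x∈p∩q) →
    let (x∈p , x∈q) = x∈p∩q⁻ p q x∈p∩q in disj x∈p x∈q

  x∈p⇒1≤∣p∣ : (p : Subset m) {x : Fin m} → x ∈ p → 1 ≤ ∣ p ∣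
  x∈p⇒1≤∣p∣ p {x} x∈p = subst (_≤ ∣ p ∣) (∣⁅x⁆∣≡1 x)
    (p⊆q⇒∣p∣≤∣q∣ λ y∈⁅x⁆ → subst (_∈ p) (sym (x∈⁅y⁆⇒x≡y x y∈⁅x⁆)) x∈p)

  unique∈⇒∣p∣≡1 : (p : Subset m) {x : Fin m} → x ∈ p → (∀ {y} → y ∈ p → y ≡ x) → ∣ p ∣ ≡ 1
  unique∈⇒∣p∣≡1 p {x} x∈p unique = trans (cong ∣_∣ p≡⁅x⁆) (∣⁅x⁆∣≡1 x)
    where
    p≡⁅x⁆ : p ≡ ⁅ x ⁆
    p≡⁅x⁆ = ⊆-antisym (λ y∈p → subst (_∈ ⁅ x ⁆) (sym (unique y∈p)) (x∈⁅x⁆ x))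
                      (λ y∈⁅x⁆ → subst (_∈ p) (sym (x∈⁅y⁆⇒x≡y x y∈⁅x⁆)) x∈p)

  ∣p∣≡1⇒nonempty : (p : Subset m) → ∣ p ∣ ≡ 1 → Nonempty p
  ∣p∣≡1⇒nonempty p ∣p∣≡1 with nonempty? p
  ... | yes ne = ne
  ... | no ¬ne = contradiction (trans (sym ∣p∣≡1) (trans (cong ∣_∣ (Empty-unique ¬ne)) (∣⊥∣≡0 m))) λ ()

-- An element of level a lies in the coordinate A_{i+1} iff a ≤ i and i ∸ a is even.
appears : (level i : ℕ) → Bool
appears zero zero = true
appears zero (suc zero) = false
appears zero (suc (suc i)) = appears zero i
appears (suc a) zero = false
appears (suc a) (suc i) = appears a i

Appears : (level i : ℕ) → Set
Appears a i = appears a i ≡ true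

Appears-coord-suc : ∀ a i → Appears a i → Appears a (suc i) → ⊥
Appears-coord-suc zero (suc zero) ()
Appears-coord-suc zero (suc (suc i)) = Appears-coord-suc zero i
Appears-coord-suc (suc a) (suc i) = Appears-coord-suc a i

Appears-level-suc : ∀ a i → Appears a i → Appears (suc a) i → ⊥
Appears-level-suc zero (suc i) a∈ sa∈ = Appears-coord-suc zero i sa∈ a∈
Appears-level-suc (suc a) (suc i) = Appears-level-suc a i

Appears-+2 : ∀ a i → Appears a i → Appears a (2 + i)
Appears-+2 zero i a∈ = a∈
Appears-+2 (suc a) (suc i) = Appears-+2 a i

Appears⇒≤ : ∀ a i → Appears a i → a ≤ i
Appears⇒≤ zero i _ = z≤n
Appears⇒≤ (suc a) (suc i) a∈ = s≤s (Appears⇒≤ a i a∈)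

Appears-0⊎1 : ∀ i → Appears 0 i ⊎ Appears 1 i
Appears-0⊎1 zero = inj₁ refl
Appears-0⊎1 (suc i) with Appears-0⊎1 i
... | inj₁ 0∈ = inj₂ 0∈
... | inj₂ 1∈ = inj₁ (Appears-1⇒0 i 1∈)
  where
  Appears-1⇒0 : ∀ i → Appears 1 i → Appears 0 (suc i)
  Appears-1⇒0 (suc i) 1∈ = 1∈

LevelStep : (k a b : ℕ) → Set
LevelStep k a b = b ≡ suc a ⊎ a ≡ suc b ⊎ (a ≡ k × b ≡ k)

LevelStep-sym : ∀ {k a b} → LevelStep k a b → LevelStep k b a
LevelStep-sym (inj₁ b≡1+a) = inj₂ (inj₁ b≡1+a)
LevelStep-sym (inj₂ (inj₁ a≡1+b)) = inj₁ a≡1+b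
LevelStep-sym (inj₂ (inj₂ (a≡k , b≡k))) = inj₂ (inj₂ (b≡k , a≡k))

module LevelEncoding (m k : ℕ) where

  levelTuple : (Fin m → ℕ) → Tuple m k
  levelTuple ℓ i = tabulate λ x → appears (ℓ x) (toℕ i)

  private
    step-disjoint : ∀ {a b} i → i < k → LevelStep k a b → Appears a i → Appears b i → ⊥
    step-disjoint {a} i _ (inj₁ refl) = Appears-level-suc a i
    step-disjoint {b = b} i _ (inj₂ (inj₁ refl)) a∈ b∈ = Appears-level-suc b i b∈ a∈
    step-disjoint {a} i i<k (inj₂ (inj₂ (refl , refl))) a∈ _ = <⇒≱ i<k (Appears⇒≤ a i a∈)

    step-up : ∀ {a b} i → i < k → LevelStep k a b → Appears a i → Appears b (suc i)
    step-up i _ (inj₁ refl) a∈ = a∈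
    step-up zero _ (inj₂ (inj₁ refl)) ()
    step-up {b = b} (suc i) _ (inj₂ (inj₁ refl)) a∈ = Appears-+2 b i a∈
    step-up {a} i i<k (inj₂ (inj₂ (refl , refl))) a∈ = ⊥-elim (<⇒≱ i<k (Appears⇒≤ a i a∈))

  levelTuple-adj : (ℓ ℓ′ : Fin m → ℕ) → (∀ x → LevelStep k (ℓ x) (ℓ′ x)) →
                   HelicalAdj m k (levelTuple ℓ) (levelTuple ℓ′)
  levelTuple-adj ℓ ℓ′ steps =
      (λ i → disjoint⇒∩≡∅ _ _ λ {x} x∈A x∈B →
         step-disjoint (toℕ i) (toℕ<n i) (steps x) (∈-tabulate⁻ _ x∈A) (∈-tabulate⁻ _ x∈B))
    , (λ i j j≡1+i {x} x∈ → ∈-tabulate⁺ _ (subst (Appears (ℓ′ x)) (sym j≡1+i)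
         (step-up (toℕ i) (toℕ<n i) (steps x) (∈-tabulate⁻ _ x∈))))
    , (λ i j j≡1+i {x} x∈ → ∈-tabulate⁺ _ (subst (Appears (ℓ x)) (sym j≡1+i)
         (step-up (toℕ i) (toℕ<n i) (LevelStep-sym (steps x)) (∈-tabulate⁻ _ x∈))))

  levelTuple-vertex : (ℓ : Fin m → ℕ) {x₀ x₁ : Fin m} → ℓ x₀ ≡ 0 → ℓ x₁ ≡ 1 →
                      (∀ y → ℓ y ≡ 0 → y ≡ x₀) → IsHelicalVertex m 1 k (levelTuple ℓ)
  levelTuple-vertex ℓ {x₀} {x₁} ℓx₀≡0 ℓx₁≡1 unique =
      (λ i i≡0 → unique∈⇒∣p∣≡1 _ (∈-tabulate⁺ _ (subst₂ Appears (sym ℓx₀≡0) (sym i≡0) refl))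
                   λ {y} y∈ → unique y (Appears-at-0 (ℓ y) (subst (Appears (ℓ y)) i≡0 (∈-tabulate⁻ _ y∈))))
    , (λ i → nonempty i (Appears-0⊎1 (toℕ i)))
    , (λ i j j≡1+i → disjoint⇒∩≡∅ _ _ λ {x} x∈A x∈B →
         Appears-coord-suc (ℓ x) (toℕ i) (∈-tabulate⁻ _ x∈A)
                           (subst (Appears (ℓ x)) j≡1+i (∈-tabulate⁻ _ x∈B)))
    , (λ i j j≡2+i {x} x∈ → ∈-tabulate⁺ _ (subst (Appears (ℓ x)) (sym j≡2+i)
         (Appears-+2 (ℓ x) (toℕ i) (∈-tabulate⁻ _ x∈))))
    where
    Appears-at-0 : ∀ a → Appears a 0 → a ≡ 0
    Appears-at-0 zero _ = refl

    nonempty : ∀ i → Appears 0 (toℕ i) ⊎ Appears 1 (toℕ i) → 1 ≤ ∣ levelTuple ℓ i ∣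
    nonempty i (inj₁ 0∈) = x∈p⇒1≤∣p∣ _ (∈-tabulate⁺ (λ x → appears (ℓ x) (toℕ i))
                                          (subst (λ a → Appears a (toℕ i)) (sym ℓx₀≡0) 0∈))
    nonempty i (inj₂ 1∈) = x∈p⇒1≤∣p∣ _ (∈-tabulate⁺ (λ x → appears (ℓ x) (toℕ i))
                                          (subst (λ a → Appears a (toℕ i)) (sym ℓx₁≡1) 1∈))

-- Possible distance between two consecutive occurrences of an element in A₁ along a walk.
Gap : (k δ : ℕ) → Set
Gap k δ = (∃[ f ] δ ≡ 2 * f × 1 ≤ f) ⊎ (∃[ f ] δ ≡ suc (2 * f) × k ≤ f)

-- The bound on the number j of occurrences of an element spread over a distance d:
-- each gap is at least 2, and an odd total forces a gap of at least 2k + 1.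
Span : (k j d : ℕ) → Set
Span k j d = (∃[ e ] d ≡ 2 * e × j ≤ suc e) ⊎ (∃[ e ] d ≡ suc (2 * e) × j + k ≤ e + 2)

Span-extend : ∀ {k j d δ} → 1 ≤ k → Span k j d → Gap k δ → Span k (suc j) (d + δ)
Span-extend _ (inj₁ (e , refl , j≤)) (inj₁ (f , refl , 1≤f)) =
  inj₁ (e + f , sym (*-distribˡ-+ 2 e f)
       , s≤s (≤-trans j≤ (subst (_≤ e + f) (+-comm e 1) (+-monoʳ-≤ e 1≤f))))
Span-extend {k} {j} _ (inj₁ (e , refl , j≤)) (inj₂ (f , refl , k≤f)) =
  inj₂ (e + f , 2e+[1+2f]≡1+2[e+f] e f
       , ≤-trans (+-mono-≤ (s≤s j≤) k≤f) (≤-reflexive (2+e+f≡e+f+2 e f)))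
  where
  2e+[1+2f]≡1+2[e+f] : ∀ e f → 2 * e + suc (2 * f) ≡ suc (2 * (e + f))
  2e+[1+2f]≡1+2[e+f] = solve-∀
  2+e+f≡e+f+2 : ∀ e f → suc (suc e) + f ≡ e + f + 2
  2+e+f≡e+f+2 = solve-∀
Span-extend {k} {j} _ (inj₂ (e , refl , j+k≤)) (inj₁ (f , refl , 1≤f)) =
  inj₂ (e + f , 1+2e+2f≡1+2[e+f] e f
       , ≤-trans (s≤s j+k≤) (≤-trans (≤-reflexive (1+[e+2]≡e+1+2 e)) (+-monoˡ-≤ 2 (+-monoʳ-≤ e 1≤f))))
  where
  1+2e+2f≡1+2[e+f] : ∀ e f → suc (2 * e) + 2 * f ≡ suc (2 * (e + f))
  1+2e+2f≡1+2[e+f] = solve-∀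
  1+[e+2]≡e+1+2 : ∀ e → suc (e + 2) ≡ e + 1 + 2
  1+[e+2]≡e+1+2 = solve-∀
Span-extend {k} {j} 1≤k (inj₂ (e , refl , j+k≤)) (inj₂ (f , refl , _)) =
  inj₁ (suc (e + f) , [1+2e]+[1+2f]≡2[1+e+f] e f
       , ≤-trans (≤-trans (subst (_≤ j + k) (+-comm j 1) (+-monoʳ-≤ j 1≤k)) j+k≤)
                 (subst (_≤ suc (suc (e + f))) (+-comm 2 e) (s≤s (s≤s (m≤m+n e f)))))
  where
  [1+2e]+[1+2f]≡2[1+e+f] : ∀ e f → suc (2 * e) + suc (2 * f) ≡ 2 * suc (e + f)
  [1+2e]+[1+2f]≡2[1+e+f] = solve-∀

module Walk {m k′ : ℕ} (w : ℕ → Tuple m (suc k′))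
            (adj : ∀ t → HelicalAdj m (suc k′) (w t) (w (suc t))) where

  private
    k : ℕ
    k = suc k′

  Occurs : (t s : ℕ) → Fin m → Set
  Occurs t s x = ∃[ i ] toℕ i ≡ s × x ∈ w t i

  private
    forward : ∀ {t s x} → suc s < k → Occurs t s x → Occurs (suc t) (suc s) x
    forward s+1<k (i , refl , x∈) =
      fromℕ< s+1<k , toℕ-fromℕ< s+1<k , proj₁ (proj₂ (adj _)) i (fromℕ< s+1<k) (toℕ-fromℕ< s+1<k) x∈

    backward : ∀ {t s x} → suc s < k → Occurs (suc t) s x → Occurs t (suc s) x
    backward s+1<k (i , refl , x∈) =
      fromℕ< s+1<k , toℕ-fromℕ< s+1<k , proj₂ (proj₂ (adj _)) i (fromℕ< s+1<k) (toℕ-fromℕ< s+1<k) x∈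

    forward* : ∀ s {a x} → s < k → Occurs a 0 x → Occurs (s + a) s x
    forward* zero _ occ = occ
    forward* (suc s) s+1<k occ = forward s+1<k (forward* s (<⇒≤ s+1<k) occ)

    backward* : ∀ s {r x} → s < k → Occurs (s + r) 0 x → Occurs r s x
    backward* zero _ occ = occ
    backward* (suc s) {r} {x} s+1<k occ =
      backward s+1<k (backward* s (<⇒≤ s+1<k) (subst (λ t → Occurs t 0 x) (sym (+-suc s r)) occ))

    Occurs-adjacent : ∀ {t s x} → Occurs t s x → Occurs (suc t) s x → ⊥
    Occurs-adjacent {t} {x = x} (i , refl , x∈) (j , j≡i , x∈′)
      with toℕ-injective {i = i} {j = j} (sym j≡i)
    ... | refl = ∉⊥ (subst (x ∈_) (proj₁ (adj t) i) (x∈p∩q⁺ (x∈ , x∈′)))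

  -- Otherwise x would lie in A_{h+1} both at time a + h (pushed forwards from a) and at time
  -- a + h + 1 (pulled backwards from a + 2h + 1), but consecutive vertices have disjoint A_{h+1}.
  odd-return : ∀ {a h x} → Occurs a 0 x → Occurs (a + suc (2 * h)) 0 x → k ≤ h
  odd-return {a} {h} {x} occ occ′ with k ≤? h
  ... | yes k≤h = k≤h
  ... | no k≰h = ⊥-elim (Occurs-adjacent (forward* h (≰⇒> k≰h) occ)
                          (backward* h (≰⇒> k≰h) (subst (λ t → Occurs t 0 x) (a+[1+2h]≡h+[1+h+a] a h) occ′)))
    where
    a+[1+2h]≡h+[1+h+a] : ∀ a h → a + suc (2 * h) ≡ h + suc (h + a)
    a+[1+2h]≡h+[1+h+a] = solve-∀

  gap : ∀ {a δ x} → 1 ≤ δ → Occurs a 0 x → Occurs (a + δ) 0 x → Gap k δ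
  gap {δ = δ} 1≤δ occ occ′ with even⊎odd δ
  ... | inj₁ (f , refl) = inj₁ (f , refl , *-cancelˡ-< 2 0 f 1≤δ)
  ... | inj₂ (f , refl) = inj₂ (f , refl , odd-return occ occ′)

  module Counting (A₁-nonempty : ∀ t → Nonempty (w t fzero)) where

    leader : ℕ → Fin m
    leader t = proj₁ (A₁-nonempty t)

    leader-occurs : ∀ t → Occurs t 0 (leader t)
    leader-occurs t = fzero , refl , proj₂ (A₁-nonempty t)

    count : Fin m → ℕ → ℕ
    count x zero = 0
    count x (suc n) = (if does (leader n ≟ x) then 1 else 0) + count x n

    ∑-count : ∀ n → ∑[ x < m ] count x n ≡ n
    ∑-count zero = sum-replicate-zero m
    ∑-count (suc n) = begin
      ∑[ x < m ] count x (suc n)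
        ≡⟨ ∑-distrib-+ (λ x → if does (leader n ≟ x) then 1 else 0) (λ x → count x n) ⟩
      ∑[ x < m ] (if does (leader n ≟ x) then 1 else 0) + ∑[ x < m ] count x n
        ≡⟨ cong₂ _+_ (∑-indicator (leader n)) (∑-count n) ⟩
      suc n ∎
      where open ≡-Reasoning

    -- Either x has not occurred before time n, or p and p + d are its first and last occurrences.
    History : Fin m → ℕ → Set
    History x n = count x n ≡ 0
                ⊎ ∃[ p ] ∃[ d ] p + d < n × Occurs p 0 x × Occurs (p + d) 0 x × Span k (count x n) d

    private
      extend : ∀ {p d q x j} → p + d < q → Occurs (p + d) 0 x → Occurs q 0 x → Span k j d →
               ∃[ d′ ] p + d′ ≡ q × Span k (suc j) d′
      extend {p} {d} {q} {x} p+d<q occ occ′ span =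
          d + (q ∸ (p + d)) , trans (sym (+-assoc p d _)) q≡
        , Span-extend (s≤s z≤n) span (gap (m<n⇒0<n∸m p+d<q) occ (subst (λ t → Occurs t 0 x) (sym q≡) occ′))
        where
        q≡ : p + d + (q ∸ (p + d)) ≡ q
        q≡ = m+[n∸m]≡n (<⇒≤ p+d<q)

    history : ∀ x n → History x n
    history x zero = inj₁ refl
    history x (suc n) with leader n ≟ x | history x n
    ... | no _ | inj₁ none = inj₁ none
    ... | no _ | inj₂ (p , d , p+d<n , rest) = inj₂ (p , d , m<n⇒m<1+n p+d<n , rest)
    ... | yes refl | inj₁ none rewrite none =
      inj₂ ( n , 0 , ≤-reflexive (cong suc (+-identityʳ n)) , occ
           , subst (λ t → Occurs t 0 (leader n)) (sym (+-identityʳ n)) occ , inj₁ (0 , refl , s≤s z≤n))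
      where occ = leader-occurs n
    ... | yes refl | inj₂ (p , d , p+d<n , occ , occ′ , span) with extend p+d<n occ′ (leader-occurs n) span
    ...   | d′ , p+d′≡n , span′ =
      inj₂ (p , d′ , ≤-reflexive (cong suc p+d′≡n) , occ
           , subst (λ t → Occurs t 0 (leader n)) (sym p+d′≡n) (leader-occurs n) , span′)

    module _ (e : ℕ) (periodic : ∀ t i → w (t + suc (2 * e)) i ≡ w t i) where

      private
        L : ℕ
        L = suc (2 * e)

      count-bound : ∀ x → 1 ≤ count x L → count x L + k′ ≤ e
      count-bound x 1≤count with history x L
      ... | inj₁ none = contradiction (subst (1 ≤_) none 1≤count) λ ()
      ... | inj₂ (p , d , p+d<L , occ , occ′ , span)
        with extend (+-monoʳ-< p (≤-trans (s≤s (m≤n+m d p)) p+d<L)) occ′ (wrap occ) span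
        where
        wrap : Occurs p 0 x → Occurs (p + L) 0 x
        wrap (i , i≡0 , x∈) = i , i≡0 , subst (x ∈_) (sym (periodic p i)) x∈
      ...   | d′ , p+d′≡p+L , span′ =
        closing (subst (Span k (suc (count x L))) (+-cancelˡ-≡ p _ _ p+d′≡p+L) span′)
        where
        closing : Span k (suc (count x L)) L → count x L + k′ ≤ e
        closing (inj₁ (e′ , L≡2e′ , _)) = contradiction (sym L≡2e′) (even≢odd e′ e)
        closing (inj₂ (e′ , L≡1+2e′ , bound)) with *-cancelˡ-≡ e e′ 2 (suc-injective L≡1+2e′)
        ... | refl = ≤-pred (≤-pred (subst₂ _≤_ (cong suc (+-suc (count x L) k′)) (+-comm e 2) bound))

      length-bound : ∃[ c′ ] e ≡ k′ + c′ × L ≤ m * c′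
      length-bound = c′ , e≡k′+c′ , subst (_≤ m * c′) (∑-count L) (∑-≤ (λ x → count x L) count≤c′)
        where
        last-occurs : 1 ≤ count (leader (2 * e)) L
        last-occurs rewrite dec-true (leader (2 * e) ≟ leader (2 * e)) refl = s≤s z≤n
        k′≤e : k′ ≤ e
        k′≤e = ≤-trans (m≤n+m k′ _) (count-bound _ last-occurs)
        c′ : ℕ
        c′ = e ∸ k′
        e≡k′+c′ : e ≡ k′ + c′
        e≡k′+c′ = sym (m+[n∸m]≡n k′≤e)
        count≤c′ : ∀ x → count x L ≤ c′
        count≤c′ x with count x L in eq
        ... | zero = z≤n
        ... | suc j = +-cancelˡ-≤ k′ _ _ (begin
          k′ + suc j      ≡⟨ +-comm k′ (suc j) ⟩
          suc j + k′      ≡⟨ cong (_+ k′) eq ⟨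
          count x L + k′  ≤⟨ count-bound x (subst (1 ≤_) (sym eq) (s≤s z≤n)) ⟩
          e               ≡⟨ e≡k′+c′ ⟩
          k′ + c′         ∎)
          where open ≤-Reasoning

HelicalAdj-congʳ : ∀ {m k} {A B B′ : Tuple m k} →
                   (∀ i → B i ≡ B′ i) → HelicalAdj m k A B → HelicalAdj m k A B′
HelicalAdj-congʳ {A = A} B≗B′ (disjoint , up , down) =
    (λ i → subst (λ X → A i ∩ X ≡ ∅) (B≗B′ i) (disjoint i))
  , (λ i j j≡1+i → subst (A i ⊆_) (B≗B′ j) (up i j j≡1+i))
  , (λ i j j≡1+i → subst (_⊆ A j) (B≗B′ i) (down i j j≡1+i))

module ClosedWalk {m k L : ℕ} .{{_ : NonZero L}} (f : ℕ → Tuple m k)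
  (step : ∀ r → suc r < L → HelicalAdj m k (f r) (f (suc r)))
  (close : ∀ r → suc r ≡ L → HelicalAdj m k (f r) (f 0)) where

  unroll : ℕ → Tuple m k
  unroll t = f (t % L)

  unroll-adj : ∀ t → HelicalAdj m k (unroll t) (unroll (suc t))
  unroll-adj t with suc-%-cases t L
  ... | inj₁ (1+r<L , next) rewrite next = step (t % L) 1+r<L
  ... | inj₂ (1+r≡L , next) rewrite next = close (t % L) 1+r≡L

  unroll-periodic : ∀ t i → unroll (t + L) i ≡ unroll t i
  unroll-periodic t i = cong (λ r → f r i) ([m+n]%n≡m%n t L)

closedWalk-length : ∀ {m′ k′ L} → Odd L → (f : ℕ → Tuple (3 + m′) (suc k′)) →
  (∀ r → suc r < L → HelicalAdj (3 + m′) (suc k′) (f r) (f (suc r))) →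
  (∀ r → suc r ≡ L → HelicalAdj (3 + m′) (suc k′) (f r) (f 0)) →
  (∀ r → ∣ f r fzero ∣ ≡ 1) →
  suc (2 * (k′ + ⌈ suc (2 * k′) / suc m′ ⌉)) ≤ L
closedWalk-length {m′} {k′} (e , refl) f step close singleton =
  let (c′ , e≡k′+c′ , L≤mc′) = length-bound e unroll-periodic
      ⌈⌉≤c′ = ⌈/⌉-least _ (suc m′) c′ (Equivalence.to (2[k+c]+1≤[3+m]c⇔2k+1≤[1+m]c m′ k′ c′)
                                          (subst (λ n → suc (2 * n) ≤ (3 + m′) * c′) e≡k′+c′ L≤mc′))
  in subst (λ n → _ ≤ suc (2 * n)) (sym e≡k′+c′) (s≤s (*-monoʳ-≤ 2 (+-monoʳ-≤ k′ ⌈⌉≤c′)))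
  where
  open ClosedWalk f step close
  open Walk unroll unroll-adj
  open Counting (λ t → ∣p∣≡1⇒nonempty _ (singleton (t % suc (2 * e))))

cycle-length : ∀ {m′ k′ L} → Odd L → HasHelicalCycle (3 + m′) 1 (suc k′) L →
               suc (2 * (k′ + ⌈ suc (2 * k′) / suc m′ ⌉)) ≤ L
cycle-length {m′} {k′} {L} (e , refl) (cycle , _ , valid , _ , consecutive , wrap) =
  closedWalk-length (e , refl) (λ r → cycle (r mod L)) step close (λ r → proj₁ (valid (r mod L)) fzero refl)
  where
  toℕ-mod : ∀ {r} → r < L → toℕ (r mod L) ≡ r
  toℕ-mod {r} r<L = trans (toℕ-fromℕ< (m%n<n r L)) (m<n⇒m%n≡m r<L)
  step : ∀ r → suc r < L → HelicalAdj (3 + m′) (suc k′) (cycle (r mod L)) (cycle (suc r mod L))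
  step r 1+r<L = consecutive (r mod L) (suc r mod L) (trans (toℕ-mod 1+r<L) (cong suc (sym (toℕ-mod (<⇒≤ 1+r<L)))))
  close : ∀ r → suc r ≡ L → HelicalAdj (3 + m′) (suc k′) (cycle (r mod L)) (cycle (0 mod L))
  close r 1+r≡L = wrap (0 mod L) (r mod L) refl (trans (cong suc (toℕ-mod (≤-reflexive 1+r≡L))) 1+r≡L)

return-length : ∀ {m′ k′} (V : ℕ → Tuple (3 + m′) (suc k′)) →
  (∀ t → HelicalAdj (3 + m′) (suc k′) (V t) (V (suc t))) → (∀ t → ∣ V t fzero ∣ ≡ 1) →
  ∀ a e → (∀ i → V (a + suc (2 * e)) i ≡ V a i) → k′ + ⌈ suc (2 * k′) / suc m′ ⌉ ≤ e
return-length {m′} {k′} V adj singleton a e return =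
  *-cancelˡ-≤ 2 (≤-pred (closedWalk-length (e , refl) (λ r → V (a + r)) step close (λ r → singleton (a + r))))
  where
  step : ∀ r → suc r < suc (2 * e) → HelicalAdj (3 + m′) (suc k′) (V (a + r)) (V (a + suc r))
  step r _ = subst (λ t → HelicalAdj (3 + m′) (suc k′) (V (a + r)) (V t)) (sym (+-suc a r)) (adj (a + r))
  close : ∀ r → suc r ≡ suc (2 * e) → HelicalAdj (3 + m′) (suc k′) (V (a + r)) (V (a + 0))
  close r 1+r≡L = HelicalAdj-congʳ (λ i → trans (cong (λ t → V t i) (trans (sym (+-suc a r)) (cong (a +_) 1+r≡L)))
                                            (trans (return i) (cong (λ t → V t i) (sym (+-identityʳ a)))))
                                   (adj (a + r))

-- Two consecutive values of a level sequence before it is capped at k.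
Step : (k a b : ℕ) → Set
Step k a b = b ≡ suc a ⊎ a ≡ suc b ⊎ (a ≡ b × k ≤ a)

Step-⊓ : ∀ {k a b} → Step k a b → LevelStep k (k ⊓ a) (k ⊓ b)
Step-⊓ {k} {a} (inj₁ refl) with a <? k
... | yes a<k = inj₁ (trans (m≥n⇒m⊓n≡n a<k) (cong suc (sym (m≥n⇒m⊓n≡n (<⇒≤ a<k)))))
... | no a≮k = inj₂ (inj₂ (m≤n⇒m⊓n≡m (≮⇒≥ a≮k) , m≤n⇒m⊓n≡m (m≤n⇒m≤1+n (≮⇒≥ a≮k))))
Step-⊓ {k} {b = b} (inj₂ (inj₁ refl)) with b <? k
... | yes b<k = inj₂ (inj₁ (trans (m≥n⇒m⊓n≡n b<k) (cong suc (sym (m≥n⇒m⊓n≡n (<⇒≤ b<k))))))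
... | no b≮k = inj₂ (inj₂ (m≤n⇒m⊓n≡m (m≤n⇒m≤1+n (≮⇒≥ b≮k)) , m≤n⇒m⊓n≡m (≮⇒≥ b≮k)))
Step-⊓ (inj₂ (inj₂ (refl , k≤a))) = inj₂ (inj₂ (m≤n⇒m⊓n≡m k≤a , m≤n⇒m⊓n≡m k≤a))

tent : (K u : ℕ) → ℕ
tent K u = u ⊓ (suc (2 * K) ∸ u)

module _ {K : ℕ} where

  private
    2K≡K+K : 2 * K ≡ K + K
    2K≡K+K = cong (K +_) (+-identityʳ K)

    2K+1∸[1+K]≡K : suc (2 * K) ∸ suc K ≡ K
    2K+1∸[1+K]≡K = trans (cong (_∸ K) 2K≡K+K) (m+n∸n≡m K K)

  tent-ascending : ∀ {u} → u ≤ K → tent K u ≡ u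
  tent-ascending {u} u≤K =
    m≤n⇒m⊓n≡m (m+n≤o⇒m≤o∸n u (≤-trans (+-mono-≤ u≤K u≤K)
                                        (≤-trans (≤-reflexive (sym 2K≡K+K)) (n≤1+n _))))

  tent-descending : ∀ {u} → K < u → tent K u ≡ suc (2 * K) ∸ u
  tent-descending {u} K<u =
    m≥n⇒m⊓n≡n (≤-trans (∸-monoʳ-≤ (suc (2 * K)) K<u)
                       (≤-trans (≤-reflexive 2K+1∸[1+K]≡K) (<⇒≤ K<u)))

  tent-step : ∀ {k u} → k ≤ K → suc u ≤ 2 * K → Step k (tent K u) (tent K (suc u))
  tent-step {k} {u} k≤K 1+u≤2K with <-cmp u K
  ... | tri< u<K _ _ = inj₁ (trans (tent-ascending u<K) (cong suc (sym (tent-ascending (<⇒≤ u<K)))))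
  ... | tri≈ _ refl _ =
    inj₂ (inj₂ ( trans (tent-ascending ≤-refl) (sym (trans (tent-descending ≤-refl) 2K+1∸[1+K]≡K))
               , subst (k ≤_) (sym (tent-ascending ≤-refl)) k≤K))
  ... | tri> _ _ K<u = inj₂ (inj₁ (trans (tent-descending K<u)
                         (trans (+-∸-assoc 1 (<⇒≤ 1+u≤2K)) (cong suc (sym (tent-descending (m<n⇒m<1+n K<u)))))))

bit : ℕ → ℕ
bit zero = 0
bit (suc zero) = 1
bit (suc (suc n)) = bit n

bit-step : ∀ {k} n → Step k (bit n) (bit (suc n))
bit-step zero = inj₁ refl
bit-step (suc zero) = inj₂ (inj₁ refl)
bit-step (suc (suc n)) = bit-step n

bit-even : ∀ j → bit (2 * j) ≡ 0
bit-even zero = refl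
bit-even (suc j) rewrite +-suc j (j + 0) = bit-even j

bit≡0⇒even : ∀ n → bit n ≡ 0 → ∃[ j ] n ≡ 2 * j
bit≡0⇒even zero _ = 0 , refl
bit≡0⇒even (suc (suc n)) bit≡0 with bit≡0⇒even n bit≡0
... | j , refl = suc j , cong suc (sym (+-suc j (j + 0)))

-- The level of an element, before capping, at phase Δ of a period of length 2C′ + 2K + 1:
-- it alternates 0, 1, …, 0 on [0, 2C′] and then rises to K and falls back to 1.
wave : (C′ K Δ : ℕ) → ℕ
wave C′ K Δ with Δ ≤? 2 * C′
... | yes _ = bit Δ
... | no _ = tent K (Δ ∸ 2 * C′)

module _ {C′ K : ℕ} where

  wave-zigzag : ∀ {Δ} → Δ ≤ 2 * C′ → wave C′ K Δ ≡ bit Δ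
  wave-zigzag {Δ} Δ≤2C′ with Δ ≤? 2 * C′
  ... | yes _ = refl
  ... | no Δ≰2C′ = contradiction Δ≤2C′ Δ≰2C′

  wave-tent : ∀ u → wave C′ K (2 * C′ + u) ≡ tent K u
  wave-tent zero =
    trans (wave-zigzag (≤-reflexive (+-identityʳ _))) (trans (cong bit (+-identityʳ (2 * C′))) (bit-even C′))
  wave-tent (suc u) with 2 * C′ + suc u ≤? 2 * C′
  ... | yes le = contradiction le (m+1+n≰m (2 * C′))
  ... | no _ = cong (tent K) (m+n∸m≡n (2 * C′) (suc u))

  wave-step : ∀ {k Δ} → k ≤ K → suc Δ < 2 * C′ + suc (2 * K) → Step k (wave C′ K Δ) (wave C′ K (suc Δ))
  wave-step {k} {Δ} k≤K 1+Δ<period with <-≤-connex Δ (2 * C′)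
  ... | inj₁ Δ<2C′ = subst₂ (Step k) (sym (wave-zigzag (<⇒≤ Δ<2C′))) (sym (wave-zigzag Δ<2C′)) (bit-step Δ)
  ... | inj₂ 2C′≤Δ = subst₂ (Step k)
          (trans (sym (wave-tent u)) (cong (wave C′ K) 2C′+u≡Δ))
          (trans (sym (wave-tent (suc u))) (cong (wave C′ K) (trans (+-suc (2 * C′) u) (cong suc 2C′+u≡Δ))))
          (tent-step k≤K 1+u≤2K)
    where
    u : ℕ
    u = Δ ∸ 2 * C′
    2C′+u≡Δ : 2 * C′ + u ≡ Δ
    2C′+u≡Δ = m+[n∸m]≡n 2C′≤Δ
    1+u≤2K : suc u ≤ 2 * K
    1+u≤2K = ≤-pred (+-cancelˡ-≤ (2 * C′) _ _ (subst (_≤ 2 * C′ + suc (2 * K))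
               (trans (cong (λ n → suc (suc n)) (sym 2C′+u≡Δ))
                      (sym (trans (+-suc (2 * C′) (suc u)) (cong suc (+-suc (2 * C′) u)))))
               1+Δ<period))

  wave-last : 1 ≤ K → wave C′ K (2 * C′ + 2 * K) ≡ 1
  wave-last 1≤K = trans (wave-tent (2 * K)) (trans (tent-descending K<2K) (m+n∸n≡m 1 (2 * K)))
    where
    K<2K : K < 2 * K
    K<2K = subst (K <_) (cong (K +_) (sym (+-identityʳ K))) (m<m+n K 1≤K)

  wave-zero⁺ : ∀ {j} → j ≤ C′ → wave C′ K (2 * j) ≡ 0
  wave-zero⁺ {j} j≤C′ = trans (wave-zigzag (*-monoʳ-≤ 2 j≤C′)) (bit-even j)

  wave-zero⁻ : ∀ {Δ} → Δ < 2 * C′ + suc (2 * K) → wave C′ K Δ ≡ 0 → ∃[ j ] Δ ≡ 2 * j × j ≤ C′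
  wave-zero⁻ {Δ} Δ<period wave≡0 with ≤-<-connex Δ (2 * C′)
  ... | inj₁ Δ≤2C′ with bit≡0⇒even Δ (trans (sym (wave-zigzag Δ≤2C′)) wave≡0)
  ...   | j , refl = j , refl , *-cancelˡ-≤ 2 Δ≤2C′
  wave-zero⁻ {Δ} Δ<period wave≡0 | inj₂ 2C′<Δ =
    contradiction (trans (sym (wave-tent u)) (trans (cong (wave C′ K) 2C′+u≡Δ) wave≡0)) (m<n⇒n≢0 tent-positive)
    where
    u : ℕ
    u = Δ ∸ 2 * C′
    2C′+u≡Δ : 2 * C′ + u ≡ Δ
    2C′+u≡Δ = m+[n∸m]≡n (<⇒≤ 2C′<Δ)
    tent-positive : 0 < tent K u
    tent-positive = ⊓-glb (m<n⇒0<n∸m 2C′<Δ)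
                          (m<n⇒0<n∸m (+-cancelˡ-< (2 * C′) u (suc (2 * K))
                                                    (subst (_< _) (sym 2C′+u≡Δ) Δ<period)))

module Construction (m k′ c : ℕ) .{{_ : NonZero c}} (capacity : suc (2 * (k′ + c)) ≤ m * c) where

  open Halving (k′ + c)
  open LevelEncoding m (suc k′)

  private
    k g : ℕ
    k = suc k′
    g = suc (2 * (k′ + c))

  start : Fin m → ℕ
  start x = toℕ x * c

  zeros : Fin m → ℕ
  zeros x = c ⊓ (g ∸ start x)

  peak : Fin m → ℕ
  peak x = suc (k′ + (c ∸ zeros x))

  offset : Fin m → ℕ
  offset x = 2 * (g ∸ start x)

  phase : Fin m → ℕ → ℕ
  phase x t = (t + offset x) % g

  profile : Fin m → ℕ → ℕ
  profile x = wave (pred (zeros x)) (peak x)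

  -- x is at level 0 at time t iff half t lies in [start x, start x + zeros x); these blocks
  -- partition [0, g) because g ≤ m c, and the elements with no block stay at the top level.
  level : Fin m → ℕ → ℕ
  level x t with start x <? g
  ... | yes _ = k ⊓ profile x (phase x t)
  ... | no _ = k

  level-used : ∀ x t → start x < g → level x t ≡ k ⊓ profile x (phase x t)
  level-used x t used with start x <? g
  ... | yes _ = refl
  ... | no unused = contradiction used unused

  module Used (x : Fin m) (used : start x < g) where

    private
      C′ K : ℕ
      C′ = pred (zeros x)
      K = peak x

    zeros>0 : 0 < zeros x
    zeros>0 = ⊓-glb (>-nonZero⁻¹ c) (m<n⇒0<n∸m used)

    period : 2 * C′ + suc (2 * K) ≡ g
    period = begin
      2 * C′ + suc (2 * K)                          ≡⟨ regroup C′ k′ (c ∸ zeros x) ⟩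
      suc (2 * (k′ + (suc C′ + (c ∸ zeros x))))     ≡⟨ cong (λ n → suc (2 * (k′ + (n + (c ∸ zeros x)))))
                                                         (suc-pred (zeros x) {{>-nonZero zeros>0}}) ⟩
      suc (2 * (k′ + (zeros x + (c ∸ zeros x))))    ≡⟨ cong (λ n → suc (2 * (k′ + n)))
                                                         (m+[n∸m]≡n (m⊓n≤m c _)) ⟩
      g                                             ∎
      where
      open ≡-Reasoning
      regroup : ∀ C′ k′ d → 2 * C′ + suc (2 * suc (k′ + d)) ≡ suc (2 * (k′ + (suc C′ + d)))
      regroup = solve-∀

    wave-advance : ∀ t → Step k (wave C′ K (phase x t)) (wave C′ K (phase x (suc t)))
    wave-advance t with suc-%-cases (t + offset x) g
    ... | inj₁ (1+Δ<g , next) rewrite next =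
      wave-step (s≤s (m≤m+n k′ _)) (subst (suc (phase x t) <_) (sym period) 1+Δ<g)
    ... | inj₂ (1+Δ≡g , next) rewrite next =
      inj₂ (inj₁ (trans (cong (wave C′ K) Δ≡)
                        (trans (wave-last {C′} (s≤s z≤n)) (cong suc (sym (wave-zero⁺ {C′} {K} z≤n))))))
      where
      Δ≡ : phase x t ≡ 2 * C′ + 2 * K
      Δ≡ = suc-injective (trans 1+Δ≡g (trans (sym period) (+-suc (2 * C′) (2 * K))))

    j<zeros⇒j≤C′ : ∀ {j} → j < zeros x → j ≤ C′
    j<zeros⇒j≤C′ = pred-mono-≤

    j≤C′⇒j<zeros : ∀ {j} → j ≤ C′ → j < zeros x
    j≤C′⇒j<zeros {j} j≤C′ = subst (suc j ≤_) (suc-pred (zeros x) {{>-nonZero zeros>0}}) (s≤s j≤C′)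

    private
      block<g : ∀ {j} → j < zeros x → start x + j < g
      block<g {j} j<Z =
        subst (start x + j <_) (m+[n∸m]≡n (<⇒≤ used)) (+-monoʳ-< (start x) (≤-trans j<Z (m⊓n≤n c _)))

      2j<g : ∀ {j} → j < zeros x → 2 * j < g
      2j<g j<Z = s≤s (*-monoʳ-≤ 2 (≤-trans (<⇒≤ (≤-trans j<Z (m⊓n≤m c _))) (m≤n+m c k′)))

      offset-cancels : ∀ a → 2 * start x + (a + offset x) ≡ a + 2 * g
      offset-cancels a = begin
        2 * start x + (a + offset x)       ≡⟨ regroup (start x) a (g ∸ start x) ⟩
        a + 2 * (start x + (g ∸ start x))  ≡⟨ cong (λ n → a + 2 * n) (m+[n∸m]≡n (<⇒≤ used)) ⟩
        a + 2 * g                          ∎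
        where
        open ≡-Reasoning
        regroup : ∀ s a d → 2 * s + (a + 2 * d) ≡ a + 2 * (s + d)
        regroup = solve-∀

    phase≡2j⇒half : ∀ t {j} → j < zeros x → phase x t ≡ 2 * j → half t ≡ start x + j
    phase≡2j⇒half t {j} j<Z phase≡2j =
      trans (half-cong {t} {2 * (start x + j)} (sym same-residue)) (half-double (block<g j<Z))
      where
      open ≡-Reasoning
      2j≡phase : 2 * j % g ≡ (t + offset x) % g
      2j≡phase = trans (cong (_% g) (sym phase≡2j)) (m%n%n≡m%n (t + offset x) g)
      same-residue : 2 * (start x + j) % g ≡ t % g
      same-residue = begin
        2 * (start x + j) % g               ≡⟨ cong (_% g) (*-distribˡ-+ 2 (start x) j) ⟩
        (2 * start x + 2 * j) % g           ≡⟨ +-cong-% {2 * start x} {2 * start x} {2 * j} {t + offset x}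
                                                         g refl 2j≡phase ⟩
        (2 * start x + (t + offset x)) % g  ≡⟨ cong (_% g) (offset-cancels t) ⟩
        (t + 2 * g) % g                     ≡⟨ [m+kn]%n≡m%n t 2 g ⟩
        t % g                               ∎

    half⇒phase≡2j : ∀ t {j} → j < zeros x → half t ≡ start x + j → phase x t ≡ 2 * j
    half⇒phase≡2j t {j} j<Z half≡ = begin
      (t + offset x) % g                  ≡⟨ +-cong-% {t} {2 * (start x + j)} {offset x} {offset x} g t≡ refl ⟩
      (2 * (start x + j) + offset x) % g  ≡⟨ cong (_% g) (trans (regroup (start x) j (g ∸ start x))
                                                                (offset-cancels (2 * j))) ⟩
      (2 * j + 2 * g) % g                 ≡⟨ [m+kn]%n≡m%n (2 * j) 2 g ⟩
      2 * j % g                           ≡⟨ m<n⇒m%n≡m (2j<g j<Z) ⟩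
      2 * j                               ∎
      where
      open ≡-Reasoning
      t≡ : t % g ≡ 2 * (start x + j) % g
      t≡ = trans (sym (double-half t)) (cong (λ n → 2 * n % g) half≡)
      regroup : ∀ s j d → 2 * (s + j) + 2 * d ≡ 2 * s + (2 * j + 2 * d)
      regroup = solve-∀

  level-step : ∀ x t → LevelStep k (level x t) (level x (suc t))
  level-step x t with start x <? g
  ... | yes used = Step-⊓ (Used.wave-advance x used t)
  ... | no _ = inj₂ (inj₂ (refl , refl))

  level-periodic : ∀ x t → level x (t + g) ≡ level x t
  level-periodic x t with start x <? g
  ... | yes _ = cong (λ Δ → k ⊓ profile x Δ) phase-periodic
    where
    phase-periodic : phase x (t + g) ≡ phase x t
    phase-periodic = trans (cong (_% g) (trans (+-assoc t g _) (trans (cong (t +_) (+-comm g _)) (sym (+-assoc t _ g)))))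
                           ([m+n]%n≡m%n (t + offset x) g)
  ... | no _ = refl

  owner<m : ∀ t → half t / c < m
  owner<m t = m<n*o⇒m/o<n (≤-trans (half<g t) capacity)

  owner : ℕ → Fin m
  owner t = fromℕ< (owner<m t)

  level-owner : ∀ t → level (owner t) t ≡ 0
  level-owner t = begin
    level x t                  ≡⟨ level-used x t used ⟩
    k ⊓ profile x (phase x t)  ≡⟨ cong (λ Δ → k ⊓ profile x Δ) (Used.half⇒phase≡2j x used t j<zeros (sym start+j≡half)) ⟩
    k ⊓ profile x (2 * j)      ≡⟨ cong (k ⊓_) (wave-zero⁺ (Used.j<zeros⇒j≤C′ x used j<zeros)) ⟩
    0                          ∎
    where
    open ≡-Reasoning
    x : Fin m
    x = owner t
    j : ℕ
    j = half t % c
    start+j≡half : start x + j ≡ half t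
    start+j≡half = begin
      toℕ x * c + j       ≡⟨ cong (λ n → n * c + j) (toℕ-fromℕ< (owner<m t)) ⟩
      half t / c * c + j  ≡⟨ +-comm _ j ⟩
      j + half t / c * c  ≡⟨ m≡m%n+[m/n]*n (half t) c ⟨
      half t              ∎
    used : start x < g
    used = ≤-<-trans (≤-trans (m≤m+n _ j) (≤-reflexive start+j≡half)) (half<g t)
    j<zeros : j < zeros x
    j<zeros = ⊓-glb (m%n<n (half t) c)
                    (m+n≤o⇒m≤o∸n (suc j) (subst (_≤ g) (cong suc (+-comm (start x) j))
                                                       (subst (_< g) (sym start+j≡half) (half<g t))))

  level≡0⇒owner : ∀ x t → level x t ≡ 0 → x ≡ owner t
  level≡0⇒owner x t level≡0 with start x <? g
  ... | no _ = contradiction level≡0 λ ()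
  ... | yes used
    with wave-zero⁻ (subst (phase x t <_) (sym (Used.period x used)) (m%n<n (t + offset x) g)) (⊓-positive level≡0)
    where
    ⊓-positive : ∀ {a} → k ⊓ a ≡ 0 → a ≡ 0
    ⊓-positive {zero} _ = refl
  ...   | j , phase≡2j , j≤C′ = toℕ-injective (begin
    toℕ x                   ≡⟨ [m*n+o]/n≡m (toℕ x) c (≤-trans j<zeros (m⊓n≤m c _)) ⟨
    (toℕ x * c + j) / c     ≡⟨ cong (_/ c) (Used.phase≡2j⇒half x used t j<zeros phase≡2j) ⟨
    half t / c              ≡⟨ toℕ-fromℕ< (owner<m t) ⟨
    toℕ (owner t)           ∎)
    where
    open ≡-Reasoning
    j<zeros : j < zeros x
    j<zeros = Used.j≤C′⇒j<zeros x used j≤C′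

  vertex : ℕ → Tuple m k
  vertex t = levelTuple λ x → level x t

  vertex-adj : ∀ t → HelicalAdj m k (vertex t) (vertex (suc t))
  vertex-adj t = levelTuple-adj _ _ λ x → level-step x t

  vertex-valid : ∀ t → IsHelicalVertex m 1 k (vertex t)
  vertex-valid t =
    levelTuple-vertex (λ x → level x t) {owner t} {owner (suc t)} (level-owner t) level-one λ y → level≡0⇒owner y t
    where
    step-to-0 : ∀ {a} → LevelStep k a 0 → a ≡ 1
    step-to-0 (inj₂ (inj₁ a≡1)) = a≡1
    level-one : level (owner (suc t)) t ≡ 1
    level-one = step-to-0 (subst (LevelStep k _) (level-owner (suc t)) (level-step (owner (suc t)) t))

  vertex-periodic : ∀ t i → vertex (t + g) i ≡ vertex t i
  vertex-periodic t i = tabulate-cong λ x → cong (λ a → appears a (toℕ i)) (level-periodic x t)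

-- If every odd closed walk along V has length at least 2h + 1, then V does not repeat within
-- one period: an even return would leave an odd return of length less than 2h + 1.
module PeriodicWalk {m n k h : ℕ} (V : ℕ → Tuple m k)
  (valid : ∀ t → IsHelicalVertex m n k (V t))
  (adj : ∀ t → HelicalAdj m k (V t) (V (suc t)))
  (periodic : ∀ t i → V (t + suc (2 * h)) i ≡ V t i)
  (long : ∀ a e → (∀ i → V (a + suc (2 * e)) i ≡ V a i) → h ≤ e) where

  period-injective : ∀ {a b} → a < b → b < suc (2 * h) → ¬ (∀ i → V b i ≡ V a i)
  period-injective {a} {b} a<b b<g Vb≗Va with even⊎odd (b ∸ a)
  ... | inj₂ (e , d≡1+2e) = <⇒≱ e<h (long a e λ i → trans (cong (λ t → V t i) a+d≡b) (Vb≗Va i))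
    where
    a+d≡b : a + suc (2 * e) ≡ b
    a+d≡b = trans (cong (a +_) (sym d≡1+2e)) (m+[n∸m]≡n (<⇒≤ a<b))
    e<h : e < h
    e<h = *-cancelˡ-< 2 e h (≤-pred (≤-trans (s≤s (≤-trans (m≤n+m _ a) (≤-reflexive a+d≡b))) b<g))
  ... | inj₁ (f , d≡2f) =
    <⇒≱ o<h (long b o λ i → trans (cong (λ t → V t i) b+1+2o≡a+g) (trans (periodic a i) (sym (Vb≗Va i))))
    where
    a+2f≡b : a + 2 * f ≡ b
    a+2f≡b = trans (cong (a +_) (sym d≡2f)) (m+[n∸m]≡n (<⇒≤ a<b))
    f≤h : f ≤ h
    f≤h = *-cancelˡ-≤ 2 (≤-pred (≤-trans (s≤s (≤-trans (m≤n+m _ a) (≤-reflexive a+2f≡b))) b<g))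
    o : ℕ
    o = h ∸ f
    o<h : o < h
    o<h = ∸-monoʳ-< (*-cancelˡ-< 2 0 f (subst (0 <_) d≡2f (m<n⇒0<n∸m a<b))) f≤h
    b+1+2o≡a+g : b + suc (2 * o) ≡ a + suc (2 * h)
    b+1+2o≡a+g = begin
      b + suc (2 * o)          ≡⟨ cong (_+ suc (2 * o)) a+2f≡b ⟨
      a + 2 * f + suc (2 * o)  ≡⟨ a+2f+[1+2o]≡a+[1+2[f+o]] a f o ⟩
      a + suc (2 * (f + o))    ≡⟨ cong (λ n → a + suc (2 * n)) (m+[n∸m]≡n f≤h) ⟩
      a + suc (2 * h)          ∎
      where
      open ≡-Reasoning
      a+2f+[1+2o]≡a+[1+2[f+o]] : ∀ a f o → a + 2 * f + suc (2 * o) ≡ a + suc (2 * (f + o))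
      a+2f+[1+2o]≡a+[1+2[f+o]] = solve-∀

  cycle : 1 ≤ h → HasHelicalCycle m n k (suc (2 * h))
  cycle 1≤h = (λ p → V (toℕ p)) , s≤s (*-monoʳ-≤ 2 1≤h) , (λ p → valid (toℕ p)) , distinct
            , (λ p q q≡1+p → subst (λ t → HelicalAdj m k (V (toℕ p)) (V t)) (sym q≡1+p) (adj (toℕ p)))
            , (λ p q p≡0 1+q≡g → HelicalAdj-congʳ (λ i → trans (cong (λ t → V t i) 1+q≡g)
                                                          (trans (periodic 0 i) (cong (λ t → V t i) (sym p≡0))))
                                                  (adj (toℕ q)))
    where
    distinct : ∀ p q → (∀ i → V (toℕ p) i ≡ V (toℕ q) i) → p ≡ q
    distinct p q p≗q with <-cmp (toℕ p) (toℕ q)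
    ... | tri< p<q _ _ = contradiction (λ i → sym (p≗q i)) (period-injective p<q (toℕ<n q))
    ... | tri≈ _ p≡q _ = toℕ-injective p≡q
    ... | tri> _ _ q<p = contradiction p≗q (period-injective q<p (toℕ<n p))

shortest-cycle : ∀ m′ k′ →
  HasHelicalCycle (3 + m′) 1 (suc k′) (suc (2 * (k′ + ⌈ suc (2 * k′) / suc m′ ⌉)))
shortest-cycle m′ k′ = PeriodicWalk.cycle vertex vertex-valid vertex-adj vertex-periodic
                         (return-length vertex vertex-adj (λ t → proj₁ (vertex-valid t) fzero refl))
                         (≤-trans c>0 (m≤n+m c k′))
  where
  c : ℕ
  c = ⌈ suc (2 * k′) / suc m′ ⌉
  cover : suc (2 * k′) ≤ suc m′ * c
  cover = ⌈/⌉-bound (suc (2 * k′)) (suc m′)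
  c>0 : 0 < c
  c>0 = n≢0⇒n>0 λ c≡0 →
    contradiction (≤-trans cover (≤-reflexive (trans (cong (suc m′ *_) c≡0) (*-zeroʳ (suc m′))))) λ ()
  open Construction (3 + m′) k′ c {{>-nonZero c>0}}
                    (Equivalence.from (2[k+c]+1≤[3+m]c⇔2k+1≤[1+m]c m′ k′ c) cover)

oddGirth≡ : ∀ m′ k′ →
  2 * suc k′ + 2 * ⌈ 2 * suc k′ ∸ 1 / suc m′ ⌉ ∸ 1 ≡ suc (2 * (k′ + ⌈ suc (2 * k′) / suc m′ ⌉))
oddGirth≡ m′ k′ = begin
  2 * suc k′ + 2 * ⌈ 2 * suc k′ ∸ 1 / suc m′ ⌉ ∸ 1  ≡⟨ cong (λ a → 2 * suc k′ + 2 * ⌈ a ∸ 1 / suc m′ ⌉ ∸ 1)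
                                                          (*-suc 2 k′) ⟩
  2 * suc k′ + 2 * c ∸ 1                           ≡⟨ cong (_∸ 1) (regroup k′ c) ⟩
  suc (2 * (k′ + c))                               ∎
  where
  open ≡-Reasoning
  c : ℕ
  c = ⌈ suc (2 * k′) / suc m′ ⌉
  regroup : ∀ k′ c → 2 * suc k′ + 2 * c ≡ suc (suc (2 * (k′ + c)))
  regroup = solve-∀

lemma3p8 : (m k : ℕ) → 3 ≤ m → 1 ≤ k →
    HelicalOddGirth m 1 k (2 * k + 2 * ⌈ 2 * k ∸ 1 / suc (m ∸ 3) ⌉ ∸ 1)
lemma3p8 (suc (suc (suc m′))) (suc k′) (s≤s (s≤s (s≤s _))) (s≤s _) =
  subst (HelicalOddGirth (3 + m′) 1 (suc k′)) (sym (oddGirth≡ m′ k′))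
        ( ((k′ + ⌈ suc (2 * k′) / suc m′ ⌉ , refl) , shortest-cycle m′ k′)
        , λ L odd cycle → cycle-length odd cycle)
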